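{- Let $p$ be a preposet of a finite set $I$ and $(S,T)$ an ordered pair of nonempty disjoint sets with $S\sqcup T=I$ and $(S,T)\le p$. Then the map $\text{m}_{(S,T)}:\text{T}^\vee_S\times\text{T}^\vee_T\to\text{T}^\vee_I$, $(h_1,h_2)\mapsto h$ with $h|_S=h_1,h|_T=h_2$, restricts to an embedding of cones $\sigma^o_{p|_S}\times\sigma^o_{p|_T}\hookrightarrow\sigma^o_p$ whose image is the face of $\sigma^o_p$ in the $\lambda_{ST}$-direction, i.e. the subset of $\sigma^o_p$ on which $h\mapsto\sum_{i\in S}h_i$ is maximized.
   Context: A preposet $p$ of $X$ is a reflexive transitive relation $\ge_p$, identified with $\{(x_1,x_2):x_1\ne x_2,\ x_1\ge_p x_2\}$; $p|_S$ is its restriction to $S$. $\text{T}^\vee_X=\{h\in\mathbb{R}^X:\sum h_x=0\}$, coroots $h_{x_1x_2}=e_{x_1}-e_{x_2}$, $\sigma^o_p=\text{Coni}\{h_{x_1x_2}:(x_2,x_1)\in p\}$. $(S,T)\le p$ means $S$ is upward-closed and $T$ downward-closed with respect to $\ge_p$.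
   Formalization: The spaces $\text{T}^\vee_S$, $\text{T}^\vee_T$, $\text{T}^\vee_I$ and the cones $\sigma^o_p$, $\sigma^o_{p|_S}$, $\sigma^o_{p|_T}$ are taken over ℚ rather than ℝ, with nonnegative rational coefficients in the conic hulls. -}

module Defs where

open import Data.Nat using (ℕ)
open import Data.Fin using (Fin; _≟_)
open import Data.Fin.Subset using (Subset; _∈_)
open import Data.Vec using (lookup)
open import Data.Bool using (Bool; true; false; if_then_else_)
open import Data.Rational using (ℚ; 0ℚ; 1ℚ; _+_; _*_; _-_; _≤_)
open import Data.List using (List; []; _∷_)
open import Data.List.Relation.Unary.All using (All)
open import Data.Product using (Σ; ∃; ∃-syntax; _×_; _,_)
open import Relation.Binary.PropositionalEquality using (_≡_; _≢_)
open import Relation.Nullary.Decidable using (⌊_⌋)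

-- Vectors in ℚ^X for X = Fin n (the finite set I is identified with Fin n).
Vect : ℕ → Set
Vect n = Fin n → ℚ

_≗ᵥ_ : ∀ {n} → Vect n → Vect n → Set
h ≗ᵥ h' = ∀ j → h j ≡ h' j

sumℚ : ∀ {n} → Vect n → ℚ
sumℚ {0} h = 0ℚ
sumℚ {ℕ.suc n} h = h Fin.zero + sumℚ (λ j → h (Fin.suc j))

TV : ∀ {n} → Vect n → Set
TV h = sumℚ h ≡ 0ℚ

e : ∀ {n} → Fin n → Vect n
e i j = if ⌊ i ≟ j ⌋ then 1ℚ else 0ℚ

coroot : ∀ {n} → Fin n → Fin n → Vect n
coroot x₁ x₂ j = e x₁ j - e x₂ j

record Preposet (n : ℕ) : Set₁ where
  field
    _≥_   : Fin n → Fin n → Set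
    ≥-refl  : ∀ x → x ≥ x
    ≥-trans : ∀ {x y z} → x ≥ y → y ≥ z → x ≥ z
open Preposet public

lincomb : ∀ {n} → List (ℚ × Vect n) → Vect n
lincomb []             j = 0ℚ
lincomb ((c , g) ∷ l)  j = c * g j + lincomb l j

Coni : ∀ {n} → (Vect n → Set) → Vect n → Set
Coni {n} G h = Σ (List (ℚ × Vect n)) λ l →
  All (λ cg → (0ℚ ≤ Data.Product.proj₁ cg) × G (Data.Product.proj₂ cg)) l × (h ≗ᵥ lincomb l)

-- generators of σ^o_p : h_{x1 x2} with (x2, x1) ∈ p, i.e. x1 ≠ x2 and x2 ≥_p x1
genσ : ∀ {n} → Preposet n → Vect n → Set
genσ p v = ∃[ x₁ ] ∃[ x₂ ] (x₁ ≢ x₂ × _≥_ p x₂ x₁ × (v ≗ᵥ coroot x₁ x₂))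

σ : ∀ {n} → Preposet n → Vect n → Set
σ p = Coni (genσ p)

-- generators of σ^o_{p|_A}, with T^∨_A viewed inside ℚ^I as vectors supported on A
genσRes : ∀ {n} → Preposet n → Subset n → Vect n → Set
genσRes p A v = ∃[ x₁ ] ∃[ x₂ ] (x₁ ∈ A × x₂ ∈ A × x₁ ≢ x₂ × _≥_ p x₂ x₁ × (v ≗ᵥ coroot x₁ x₂))

σRes : ∀ {n} → Preposet n → Subset n → Vect n → Set
σRes p A = Coni (genσRes p A)

-- (S,T) ≤ p : S upward closed, T downward closed
UpClosed : ∀ {n} → Preposet n → Subset n → Set
UpClosed p S = ∀ x y → _≥_ p x y → y ∈ S → x ∈ S

DownClosed : ∀ {n} → Preposet n → Subset n → Set
DownClosed p T = ∀ x y → _≥_ p x y → x ∈ T → y ∈ T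

-- m_{(S,T)}(h₁,h₂) = h with h|_S = h₁, h|_T = h₂ (T = complement of S)
mST : ∀ {n} → Subset n → Vect n → Vect n → Vect n
mST S h₁ h₂ i = if lookup S i then h₁ i else h₂ i

λS : ∀ {n} → Subset n → Vect n → ℚ
λS S h = sumℚ (λ i → if lookup S i then h i else 0ℚ)

Face : ∀ {n} → Preposet n → Subset n → Vect n → Set
Face p S h = σ p h × (∀ h' → σ p h' → λS S h' ≤ λS S h)

{-# OPTIONS --safe #-}

-- Because S is upward closed, λ_{ST} is ≤ 0 on every generator h_{x₁x₂} (x₂ ≥_p x₁) of σ^o_p:
-- it is 0 when x₁ and x₂ lie on the same side and −1 when x₁ ∈ T, x₂ ∈ S. Hence the maximum of
-- λ_{ST} on σ^o_p is its value 0 at the origin, and a nonnegative combination of generators attains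
-- it exactly when every crossing generator has coefficient 0, that is, when it is the sum of an
-- element of σ^o_{p|S} and one of σ^o_{p|T}. These are supported on S and on T, so on them
-- m_{(S,T)} is just addition, which also makes it injective.

module Submission where

open import Defs
open import Data.Fin.Subset using (Subset; _∈_; Nonempty)
open import Data.Product using (Σ; ∃; ∃-syntax; _×_; _,_)
open import Data.Sum using (_⊎_)
open import Data.Empty using (⊥)

open import Algebra.Bundles using (Ring; CommutativeMonoid)
open import Data.Bool using (true; false; if_then_else_)
open import Data.Bool.Properties using (¬-not; if-eta)
open import Data.Empty using (⊥-elim)
open import Data.Fin using (Fin; zero; suc; _≟_)
open import Data.Fin.Subset using (_∉_)
open import Data.List using ([]; _∷_)
open import Data.List.Relation.Unary.All using (All; []; _∷_)
open import Data.Nat using (ℕ)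
open import Data.Product using (proj₁; proj₂)
open import Data.Rational using (ℚ; 0ℚ; 1ℚ; _+_; _*_; _-_; -_; _≤_; nonNegative)
open import Data.Rational.Properties
  using ( +-assoc; +-comm; +-identityˡ; +-identityʳ; +-inverseʳ; *-zeroˡ; *-zeroʳ; *-identityˡ; *-identityʳ
        ; neg-distribʳ-*; neg-injective; ≤-reflexive; ≤-antisym; ≤-trans; +-mono-≤; +-monoʳ-≤
        ; *-monoˡ-≤-nonNeg; nonPositive⁻¹; +-*-ring; +-0-commutativeMonoid )
open import Data.Sum using (inj₁; inj₂)
open import Data.Vec using (_∷_; lookup)
open import Data.Vec.Properties using ([]=⇒lookup; lookup⇒[]=)
open import Function using (_∘_)
open import Relation.Binary.PropositionalEquality
open import Relation.Nullary using (yes; no)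

open import Algebra.Properties.Ring +-*-ring using (-1*x≈-x)
open import Algebra.Properties.Semiring.Sum (Ring.semiring +-*-ring)
  using (sum; sum-cong-≗; sum-replicate-zero; ∑-distrib-+; *-distribˡ-sum)
open import Algebra.Properties.CommutativeSemigroup
  (CommutativeMonoid.commutativeSemigroup +-0-commutativeMonoid) using (x∙yz≈y∙xz)

private variable
  n : ℕ
  c : ℚ
  f g h h₁ h₂ h₁′ h₂′ : Vect n
  A : Subset n
  G G′ : Vect n → Set
  φ : Vect n → ℚ

p≤0⇒q≤0⇒0≤p+q⇒p≡0 : ∀ {p q} → p ≤ 0ℚ → q ≤ 0ℚ → 0ℚ ≤ p + q → p ≡ 0ℚ
p≤0⇒q≤0⇒0≤p+q⇒p≡0 {p} {q} p≤0 q≤0 0≤p+q =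
  ≤-antisym p≤0 (≤-trans 0≤p+q (≤-trans (+-monoʳ-≤ p q≤0) (≤-reflexive (+-identityʳ p))))

0≤p⇒q≤0⇒p*q≤0 : ∀ {p q} → 0ℚ ≤ p → q ≤ 0ℚ → p * q ≤ 0ℚ
0≤p⇒q≤0⇒p*q≤0 {p} 0≤p q≤0 =
  ≤-trans (*-monoˡ-≤-nonNeg p {{nonNegative 0≤p}} q≤0) (≤-reflexive (*-zeroʳ p))

p-q≡-1*q+p : ∀ p q → p - q ≡ - 1ℚ * q + p
p-q≡-1*q+p p q = trans (+-comm p (- q)) (cong (_+ p) (sym (-1*x≈-x q)))

0ᵥ : Vect n
0ᵥ _ = 0ℚ

infixl 6 _+ᵥ_
infixl 7 _*ᵥ_

_+ᵥ_ : Vect n → Vect n → Vect n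
(f +ᵥ g) j = f j + g j

_*ᵥ_ : ℚ → Vect n → Vect n
(c *ᵥ f) j = c * f j

Coni-0ᵥ : Coni G 0ᵥ
Coni-0ᵥ = [] , [] , λ _ → refl

Coni-resp : f ≗ᵥ g → Coni G f → Coni G g
Coni-resp f≗g (l , gens , f≗l) = l , gens , λ j → trans (sym (f≗g j)) (f≗l j)

Coni-*+ : 0ℚ ≤ c → G g → Coni G h → Coni G (c *ᵥ g +ᵥ h)
Coni-*+ {c = c} {g = g} 0≤c Gg (l , gens , h≗l) =
  (c , g) ∷ l , (0≤c , Gg) ∷ gens , λ j → cong (c * g j +_) (h≗l j)

Coni-ind : (P : Vect n → Set)
  → (∀ {f g} → f ≗ᵥ g → P f → P g)
  → P 0ᵥ
  → (∀ {c g h} → 0ℚ ≤ c → G g → Coni G h → P h → P (c *ᵥ g +ᵥ h))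
  → Coni G h → P h
Coni-ind {G = G} P resp base step (l , gens , h≗l) = resp (λ j → sym (h≗l j)) (go l gens)
  where
  go : ∀ l → All (λ cg → (0ℚ ≤ proj₁ cg) × G (proj₂ cg)) l → P (lincomb l)
  go []            []                 = base
  go ((c , g) ∷ l) ((0≤c , Gg) ∷ gens) = step 0≤c Gg (l , gens , λ _ → refl) (go l gens)

Coni-mono : (∀ {g} → G g → G′ g) → Coni G h → Coni G′ h
Coni-mono {G′ = G′} G⊆G′ = Coni-ind (Coni G′) Coni-resp Coni-0ᵥ (λ 0≤c Gg _ → Coni-*+ 0≤c (G⊆G′ Gg))

Coni-+ᵥ : Coni G f → Coni G h → Coni G (f +ᵥ h)
Coni-+ᵥ {G = G} {h = h} cf ch = Coni-ind (λ f → Coni G (f +ᵥ h))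
  (λ f≗g → Coni-resp (λ j → cong (_+ h j) (f≗g j)))
  (Coni-resp (λ j → sym (+-identityˡ (h j))) ch)
  (λ {c} {g} {f} 0≤c Gg _ cfh → Coni-resp (λ j → sym (+-assoc (c * g j) (f j) (h j))) (Coni-*+ 0≤c Gg cfh))
  cf

record IsLinearForm (φ : Vect n → ℚ) : Set where
  field
    resp-≗       : f ≗ᵥ g → φ f ≡ φ g
    preserves-0ᵥ : φ 0ᵥ ≡ 0ℚ
    preserves-*+ : ∀ c f g → φ (c *ᵥ f +ᵥ g) ≡ c * φ f + φ g

  preserves-+ᵥ : ∀ f g → φ (f +ᵥ g) ≡ φ f + φ g
  preserves-+ᵥ f g = begin
    φ (f +ᵥ g)            ≡⟨ resp-≗ (λ j → cong (_+ g j) (*-identityˡ (f j))) ⟨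
    φ (1ℚ *ᵥ f +ᵥ g)      ≡⟨ preserves-*+ 1ℚ f g ⟩
    1ℚ * φ f + φ g        ≡⟨ cong (_+ φ g) (*-identityˡ (φ f)) ⟩
    φ f + φ g             ∎
    where open ≡-Reasoning

open IsLinearForm

Coni-nonPos : IsLinearForm φ → (∀ {g} → G g → φ g ≤ 0ℚ) → Coni G h → φ h ≤ 0ℚ
Coni-nonPos {φ = φ} lin φ≤0 = Coni-ind (λ h → φ h ≤ 0ℚ)
  (λ f≗g → ≤-trans (≤-reflexive (sym (resp-≗ lin f≗g))))
  (≤-reflexive (preserves-0ᵥ lin))
  (λ {c} {g} {h} 0≤c Gg _ φh≤0 → begin
    φ (c *ᵥ g +ᵥ h)   ≡⟨ preserves-*+ lin c g h ⟩
    c * φ g + φ h     ≤⟨ +-mono-≤ (0≤p⇒q≤0⇒p*q≤0 0≤c (φ≤0 Gg)) φh≤0 ⟩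
    0ℚ + 0ℚ           ≡⟨ +-identityʳ 0ℚ ⟩
    0ℚ                ∎)
  where open Data.Rational.Properties.≤-Reasoning

Coni-zero : IsLinearForm φ → (∀ {g} → G g → φ g ≡ 0ℚ) → Coni G h → φ h ≡ 0ℚ
Coni-zero {φ = φ} lin φ≡0 = Coni-ind (λ h → φ h ≡ 0ℚ)
  (λ f≗g → trans (sym (resp-≗ lin f≗g)))
  (preserves-0ᵥ lin)
  (λ {c} {g} {h} _ Gg _ φh≡0 → begin
    φ (c *ᵥ g +ᵥ h)   ≡⟨ preserves-*+ lin c g h ⟩
    c * φ g + φ h     ≡⟨ cong₂ (λ a b → c * a + b) (φ≡0 Gg) φh≡0 ⟩
    c * 0ℚ + 0ℚ       ≡⟨ trans (+-identityʳ (c * 0ℚ)) (*-zeroʳ c) ⟩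
    0ℚ                ∎)
  where open ≡-Reasoning

eval-isLinearForm : (j : Fin n) → IsLinearForm (λ h → h j)
eval-isLinearForm j = record
  { resp-≗       = λ f≗g → f≗g j
  ; preserves-0ᵥ = refl
  ; preserves-*+ = λ _ _ _ → refl
  }

sumℚ≡sum : (h : Vect n) → sumℚ h ≡ sum h
sumℚ≡sum {ℕ.zero}  h = refl
sumℚ≡sum {ℕ.suc n} h = cong (h zero +_) (sumℚ≡sum (h ∘ suc))

sumℚ-isLinearForm : IsLinearForm (sumℚ {n})
sumℚ-isLinearForm {n} = record
  { resp-≗       = λ {f} {g} f≗g → trans (sumℚ≡sum f) (trans (sum-cong-≗ f≗g) (sym (sumℚ≡sum g)))
  ; preserves-0ᵥ = trans (sumℚ≡sum {n} 0ᵥ) (sum-replicate-zero n)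
  ; preserves-*+ = λ c f g → begin
      sumℚ (c *ᵥ f +ᵥ g)     ≡⟨ sumℚ≡sum (c *ᵥ f +ᵥ g) ⟩
      sum (c *ᵥ f +ᵥ g)      ≡⟨ ∑-distrib-+ (c *ᵥ f) g ⟩
      sum (c *ᵥ f) + sum g   ≡⟨ cong (_+ sum g) (*-distribˡ-sum c f) ⟨
      c * sum f + sum g      ≡⟨ cong₂ (λ a b → c * a + b) (sumℚ≡sum f) (sumℚ≡sum g) ⟨
      c * sumℚ f + sumℚ g    ∎
  }
  where open ≡-Reasoning

indicator : Subset n → Fin n → ℚ
indicator A i = if lookup A i then 1ℚ else 0ℚ

restrict : Subset n → Vect n → Vect n
restrict A h i = if lookup A i then h i else 0ℚ

λS-isLinearForm : (A : Subset n) → IsLinearForm (λS A)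
λS-isLinearForm {n} A = record
  { resp-≗       = λ f≗g → resp-≗ sumℚ-lin (λ j → cong (λ x → if lookup A j then x else 0ℚ) (f≗g j))
  ; preserves-0ᵥ = trans (resp-≗ sumℚ-lin (λ j → if-eta (lookup A j)))
                         (preserves-0ᵥ sumℚ-lin)
  ; preserves-*+ = λ c f g → trans (resp-≗ sumℚ-lin (restrict-*+ c f g))
                                   (preserves-*+ sumℚ-lin c (restrict A f) (restrict A g))
  }
  where
  sumℚ-lin : IsLinearForm (sumℚ {n})
  sumℚ-lin = sumℚ-isLinearForm
  restrict-*+ : ∀ c f g → restrict A (c *ᵥ f +ᵥ g) ≗ᵥ (c *ᵥ restrict A f +ᵥ restrict A g)
  restrict-*+ c f g j with lookup A j
  ... | true  = refl
  ... | false = sym (trans (+-identityʳ (c * 0ℚ)) (*-zeroʳ c))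

e-suc : (i j : Fin n) → e (suc i) (suc j) ≡ e i j
e-suc i j with i ≟ j
... | yes _ = refl
... | no  _ = refl

λS-e : (A : Subset n) (i : Fin n) → λS A (e i) ≡ indicator A i
λS-e (b ∷ A) zero    = trans (cong (indicator (b ∷ A) zero +_) (preserves-0ᵥ (λS-isLinearForm A)))
                             (+-identityʳ _)
λS-e (b ∷ A) (suc i) = begin
  (if b then 0ℚ else 0ℚ) + λS A (e (suc i) ∘ suc)   ≡⟨ cong₂ _+_ (if-eta b) (resp-≗ (λS-isLinearForm A) (e-suc i)) ⟩
  0ℚ + λS A (e i)                                  ≡⟨ +-identityˡ _ ⟩
  λS A (e i)                                       ≡⟨ λS-e A i ⟩
  indicator A i                                    ∎
  where open ≡-Reasoning

λS-coroot : (A : Subset n) (x₁ x₂ : Fin n) → λS A (coroot x₁ x₂) ≡ indicator A x₁ - indicator A x₂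
λS-coroot A x₁ x₂ = begin
  λS A (coroot x₁ x₂)                      ≡⟨ resp-≗ lin (λ j → p-q≡-1*q+p (e x₁ j) (e x₂ j)) ⟩
  λS A ((- 1ℚ) *ᵥ e x₂ +ᵥ e x₁)             ≡⟨ preserves-*+ lin (- 1ℚ) (e x₂) (e x₁) ⟩
  - 1ℚ * λS A (e x₂) + λS A (e x₁)          ≡⟨ cong₂ (λ a b → - 1ℚ * a + b) (λS-e A x₂) (λS-e A x₁) ⟩
  - 1ℚ * indicator A x₂ + indicator A x₁   ≡⟨ p-q≡-1*q+p (indicator A x₁) (indicator A x₂) ⟨
  indicator A x₁ - indicator A x₂          ∎
  where
  open ≡-Reasoning
  lin : IsLinearForm (λS A)
  lin = λS-isLinearForm A

λS-coroot-≡0 : (A : Subset n) {x₁ x₂ : Fin n} → lookup A x₁ ≡ lookup A x₂ → λS A (coroot x₁ x₂) ≡ 0ℚ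
λS-coroot-≡0 A {x₁} {x₂} same = begin
  λS A (coroot x₁ x₂)                ≡⟨ λS-coroot A x₁ x₂ ⟩
  indicator A x₁ - indicator A x₂    ≡⟨ cong (λ b → (if b then 1ℚ else 0ℚ) - indicator A x₂) same ⟩
  indicator A x₂ - indicator A x₂    ≡⟨ +-inverseʳ (indicator A x₂) ⟩
  0ℚ                                 ∎
  where open ≡-Reasoning

∉⇒lookup≡false : {i : Fin n} → i ∉ A → lookup A i ≡ false
∉⇒lookup≡false {A = A} {i} i∉A = ¬-not (i∉A ∘ lookup⇒[]= i A)

mST-∈ : (f g : Vect n) {i : Fin n} → i ∈ A → mST A f g i ≡ f i
mST-∈ f g {i} i∈A = cong (if_then f i else g i) ([]=⇒lookup i∈A)

mST-∉ : (f g : Vect n) {i : Fin n} → i ∉ A → mST A f g i ≡ g i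
mST-∉ f g {i} i∉A = cong (if_then f i else g i) (∉⇒lookup≡false i∉A)

e-vanishes : {i j : Fin n} → i ≢ j → e i j ≡ 0ℚ
e-vanishes {i = i} {j} i≢j with i ≟ j
... | yes i≡j = ⊥-elim (i≢j i≡j)
... | no  _   = refl

σRes-vanishes : (p : Preposet n) {j : Fin n} → j ∉ A → σRes p A h → h j ≡ 0ℚ
σRes-vanishes {A = A} p {j} j∉A = Coni-zero (eval-isLinearForm j) genσRes-vanishes
  where
  genσRes-vanishes : ∀ {g} → genσRes p A g → g j ≡ 0ℚ
  genσRes-vanishes (x₁ , x₂ , x₁∈A , x₂∈A , _ , _ , g≗) =
    trans (g≗ j) (cong₂ _-_ (e-vanishes {i = x₁} λ { refl → j∉A x₁∈A })
                             (e-vanishes {i = x₂} λ { refl → j∉A x₂∈A }))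

σRes⊆σ : (p : Preposet n) (A : Subset n) → σRes p A h → σ p h
σRes⊆σ p A = Coni-mono λ (x₁ , x₂ , _ , _ , gen) → x₁ , x₂ , gen

λS-genσRes-≡0 : (p : Preposet n) (S : Subset n) → (∀ {i j} → i ∈ A → j ∈ A → lookup S i ≡ lookup S j)
  → genσRes p A g → λS S g ≡ 0ℚ
λS-genσRes-≡0 p S same (x₁ , x₂ , x₁∈A , x₂∈A , _ , _ , g≗) =
  trans (resp-≗ (λS-isLinearForm S) g≗) (λS-coroot-≡0 S (same x₁∈A x₂∈A))

λS-σRes-≡0 : (p : Preposet n) (S : Subset n) → (∀ {i j} → i ∈ A → j ∈ A → lookup S i ≡ lookup S j)
  → σRes p A h → λS S h ≡ 0ℚ
λS-σRes-≡0 p S same = Coni-zero (λS-isLinearForm S) (λS-genσRes-≡0 p S same)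

module Decomposition {n} (p : Preposet n) (S T : Subset n)
  (disjoint : ∀ i → i ∈ S → i ∈ T → ⊥) (cover : ∀ i → i ∈ S ⊎ i ∈ T)
  (S-up : UpClosed p S) where

  open IsLinearForm (λS-isLinearForm S)
    renaming (resp-≗ to λS-resp; preserves-0ᵥ to λS-0ᵥ; preserves-*+ to λS-*+; preserves-+ᵥ to λS-+ᵥ)

  ∈T⇒∉S : ∀ {i} → i ∈ T → i ∉ S
  ∈T⇒∉S i∈T i∈S = disjoint _ i∈S i∈T

  ∈S⇒∉T : ∀ {i} → i ∈ S → i ∉ T
  ∈S⇒∉T i∈S i∈T = disjoint _ i∈S i∈T

  S-uniform : ∀ {i j} → i ∈ S → j ∈ S → lookup S i ≡ lookup S j
  S-uniform i∈S j∈S = trans ([]=⇒lookup i∈S) (sym ([]=⇒lookup j∈S))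

  T-uniform : ∀ {i j} → i ∈ T → j ∈ T → lookup S i ≡ lookup S j
  T-uniform i∈T j∈T = trans (∉⇒lookup≡false (∈T⇒∉S i∈T)) (sym (∉⇒lookup≡false (∈T⇒∉S j∈T)))

  classify : genσ p g → genσRes p S g ⊎ genσRes p T g ⊎ λS S g ≡ - 1ℚ
  classify (x₁ , x₂ , x₁≢x₂ , x₂≥x₁ , g≗) with cover x₁ | cover x₂
  ... | inj₁ x₁∈S | inj₁ x₂∈S = inj₁ (x₁ , x₂ , x₁∈S , x₂∈S , x₁≢x₂ , x₂≥x₁ , g≗)
  ... | inj₂ x₁∈T | inj₂ x₂∈T = inj₂ (inj₁ (x₁ , x₂ , x₁∈T , x₂∈T , x₁≢x₂ , x₂≥x₁ , g≗))
  ... | inj₂ x₁∈T | inj₁ x₂∈S = inj₂ (inj₂ (trans (λS-resp g≗) (trans (λS-coroot S x₁ x₂)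
          (cong₂ (λ b₁ b₂ → (if b₁ then 1ℚ else 0ℚ) - (if b₂ then 1ℚ else 0ℚ))
                 (∉⇒lookup≡false (∈T⇒∉S x₁∈T)) ([]=⇒lookup x₂∈S)))))
  ... | inj₁ x₁∈S | inj₂ x₂∈T = ⊥-elim (disjoint x₂ (S-up x₂ x₁ x₂≥x₁ x₁∈S) x₂∈T)

  λS-genσ-nonPos : genσ p g → λS S g ≤ 0ℚ
  λS-genσ-nonPos gen with classify gen
  ... | inj₁ gS          = ≤-reflexive (λS-genσRes-≡0 p S S-uniform gS)
  ... | inj₂ (inj₁ gT)    = ≤-reflexive (λS-genσRes-≡0 p S T-uniform gT)
  ... | inj₂ (inj₂ λg≡-1) = ≤-trans (≤-reflexive λg≡-1) (nonPositive⁻¹ (- 1ℚ))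

  σ-λS-nonPos : σ p h → λS S h ≤ 0ℚ
  σ-λS-nonPos = Coni-nonPos (λS-isLinearForm S) λS-genσ-nonPos

  Face⇒λS≡0 : Face p S h → λS S h ≡ 0ℚ
  Face⇒λS≡0 {h = h} (σh , maximal) =
    ≤-antisym (σ-λS-nonPos σh) (≤-trans (≤-reflexive (sym λS-0ᵥ)) (maximal 0ᵥ Coni-0ᵥ))

  λS≡0⇒Face : σ p h → λS S h ≡ 0ℚ → Face p S h
  λS≡0⇒Face σh λSh≡0 = σh , λ h′ σh′ → ≤-trans (σ-λS-nonPos σh′) (≤-reflexive (sym λSh≡0))

  mST-≗-+ᵥ : σRes p S h₁ → σRes p T h₂ → mST S h₁ h₂ ≗ᵥ (h₁ +ᵥ h₂)
  mST-≗-+ᵥ {h₁ = h₁} {h₂ = h₂} s t j with cover j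
  ... | inj₁ j∈S = begin
    mST S h₁ h₂ j   ≡⟨ mST-∈ h₁ h₂ j∈S ⟩
    h₁ j            ≡⟨ +-identityʳ (h₁ j) ⟨
    h₁ j + 0ℚ       ≡⟨ cong (h₁ j +_) (σRes-vanishes p (∈S⇒∉T j∈S) t) ⟨
    h₁ j + h₂ j     ∎
    where open ≡-Reasoning
  ... | inj₂ j∈T = begin
    mST S h₁ h₂ j   ≡⟨ mST-∉ h₁ h₂ (∈T⇒∉S j∈T) ⟩
    h₂ j            ≡⟨ +-identityˡ (h₂ j) ⟨
    0ℚ + h₂ j       ≡⟨ cong (_+ h₂ j) (σRes-vanishes p (∈T⇒∉S j∈T) s) ⟨
    h₁ j + h₂ j     ∎
    where open ≡-Reasoning

  mST-injective : σRes p S h₁ → σRes p T h₂ → σRes p S h₁′ → σRes p T h₂′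
    → mST S h₁ h₂ ≗ᵥ mST S h₁′ h₂′ → (h₁ ≗ᵥ h₁′) × (h₂ ≗ᵥ h₂′)
  mST-injective {h₁ = h₁} {h₂ = h₂} {h₁′ = h₁′} {h₂′ = h₂′} s t s′ t′ m≗m′ = agree₁ , agree₂
    where
    agree₁ : h₁ ≗ᵥ h₁′
    agree₁ j with cover j
    ... | inj₁ j∈S = trans (sym (mST-∈ h₁ h₂ j∈S)) (trans (m≗m′ j) (mST-∈ h₁′ h₂′ j∈S))
    ... | inj₂ j∈T = trans (σRes-vanishes p (∈T⇒∉S j∈T) s) (sym (σRes-vanishes p (∈T⇒∉S j∈T) s′))
    agree₂ : h₂ ≗ᵥ h₂′
    agree₂ j with cover j
    ... | inj₁ j∈S = trans (σRes-vanishes p (∈S⇒∉T j∈S) t) (sym (σRes-vanishes p (∈S⇒∉T j∈S) t′))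
    ... | inj₂ j∈T = trans (sym (mST-∉ h₁ h₂ (∈T⇒∉S j∈T))) (trans (m≗m′ j) (mST-∉ h₁′ h₂′ (∈T⇒∉S j∈T)))

  Split : Vect n → Set
  Split h = ∃[ h₁ ] ∃[ h₂ ] (σRes p S h₁ × σRes p T h₂ × (h ≗ᵥ (h₁ +ᵥ h₂)))

  Split-resp : f ≗ᵥ g → Split f → Split g
  Split-resp f≗g (h₁ , h₂ , s , t , f≗) = h₁ , h₂ , s , t , λ j → trans (sym (f≗g j)) (f≗ j)

  Split-0ᵥ : Split 0ᵥ
  Split-0ᵥ = 0ᵥ , 0ᵥ , Coni-0ᵥ , Coni-0ᵥ , λ _ → sym (+-identityʳ 0ℚ)

  Split-*+S : 0ℚ ≤ c → genσRes p S g → Split h → Split (c *ᵥ g +ᵥ h)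
  Split-*+S {c = c} {g = g} 0≤c gS (h₁ , h₂ , s , t , h≗) =
    c *ᵥ g +ᵥ h₁ , h₂ , Coni-*+ 0≤c gS s , t ,
    λ j → trans (cong (c * g j +_) (h≗ j)) (sym (+-assoc (c * g j) (h₁ j) (h₂ j)))

  Split-*+T : 0ℚ ≤ c → genσRes p T g → Split h → Split (c *ᵥ g +ᵥ h)
  Split-*+T {c = c} {g = g} 0≤c gT (h₁ , h₂ , s , t , h≗) =
    h₁ , c *ᵥ g +ᵥ h₂ , s , Coni-*+ 0≤c gT t ,
    λ j → trans (cong (c * g j +_) (h≗ j)) (x∙yz≈y∙xz (c * g j) (h₁ j) (h₂ j))

  Split-0*+ : c ≡ 0ℚ → Split h → Split (c *ᵥ g +ᵥ h)
  Split-0*+ {c = c} {h = h} {g = g} refl = Split-resp λ j →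
    sym (trans (cong (_+ h j) (*-zeroˡ (g j))) (+-identityˡ (h j)))

  0≤λS[c*g+h]⇒c*λS[g]≡0×0≤λS[h] : 0ℚ ≤ c → genσ p g → σ p h → 0ℚ ≤ λS S (c *ᵥ g +ᵥ h)
    → c * λS S g ≡ 0ℚ × 0ℚ ≤ λS S h
  0≤λS[c*g+h]⇒c*λS[g]≡0×0≤λS[h] {c = c} {g = g} {h = h} 0≤c gen σh 0≤λ =
    p≤0⇒q≤0⇒0≤p+q⇒p≡0 cλg≤0 λh≤0 0≤sum ,
    ≤-reflexive (sym (p≤0⇒q≤0⇒0≤p+q⇒p≡0 λh≤0 cλg≤0 (≤-trans 0≤sum (≤-reflexive (+-comm (c * λS S g) (λS S h))))))
    where
    cλg≤0 : c * λS S g ≤ 0ℚ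
    cλg≤0 = 0≤p⇒q≤0⇒p*q≤0 0≤c (λS-genσ-nonPos gen)
    λh≤0 : λS S h ≤ 0ℚ
    λh≤0 = σ-λS-nonPos σh
    0≤sum : 0ℚ ≤ c * λS S g + λS S h
    0≤sum = ≤-trans 0≤λ (≤-reflexive (λS-*+ c g h))

  decompose : σ p h → 0ℚ ≤ λS S h → Split h
  decompose = Coni-ind (λ h → 0ℚ ≤ λS S h → Split h)
    (λ f≗g split-f 0≤λg → Split-resp f≗g (split-f (≤-trans 0≤λg (≤-reflexive (sym (λS-resp f≗g))))))
    (λ _ → Split-0ᵥ)
    step
    where
    step : 0ℚ ≤ c → genσ p g → σ p h → (0ℚ ≤ λS S h → Split h) → 0ℚ ≤ λS S (c *ᵥ g +ᵥ h) → Split (c *ᵥ g +ᵥ h)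
    step {c = c} {g = g} 0≤c gen σh ih 0≤λ with 0≤λS[c*g+h]⇒c*λS[g]≡0×0≤λS[h] 0≤c gen σh 0≤λ | classify gen
    ... | _      , 0≤λh | inj₁ gS          = Split-*+S 0≤c gS (ih 0≤λh)
    ... | _      , 0≤λh | inj₂ (inj₁ gT)    = Split-*+T 0≤c gT (ih 0≤λh)
    ... | cλg≡0  , 0≤λh | inj₂ (inj₂ λg≡-1) = Split-0*+ c≡0 (ih 0≤λh)
      where
      c≡0 : c ≡ 0ℚ
      c≡0 = neg-injective (begin
        - c              ≡⟨ cong -_ (*-identityʳ c) ⟨
        - (c * 1ℚ)       ≡⟨ neg-distribʳ-* c 1ℚ ⟩
        c * - 1ℚ         ≡⟨ cong (c *_) λg≡-1 ⟨
        c * λS S g       ≡⟨ cλg≡0 ⟩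
        0ℚ               ∎)
        where open ≡-Reasoning

  Image : Vect n → Set
  Image h = ∃[ h₁ ] ∃[ h₂ ] (σRes p S h₁ × σRes p T h₂ × (mST S h₁ h₂ ≗ᵥ h))

  mST-σ : ∀ h₁ h₂ → σRes p S h₁ → σRes p T h₂ → σ p (mST S h₁ h₂)
  mST-σ h₁ h₂ s t = Coni-resp (λ j → sym (mST-≗-+ᵥ s t j)) (Coni-+ᵥ (σRes⊆σ p S s) (σRes⊆σ p T t))

  Face⇒Image : Face p S h → Image h
  Face⇒Image face@(σh , _) with decompose σh (≤-reflexive (sym (Face⇒λS≡0 face)))
  ... | h₁ , h₂ , s , t , h≗ = h₁ , h₂ , s , t , λ j → trans (mST-≗-+ᵥ s t j) (sym (h≗ j))

  Image⇒Face : Image h → Face p S h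
  Image⇒Face {h = h} (h₁ , h₂ , s , t , m≗h) =
    λS≡0⇒Face (Coni-resp m≗h (mST-σ h₁ h₂ s t)) (begin
      λS S h                           ≡⟨ λS-resp (λ j → trans (sym (m≗h j)) (mST-≗-+ᵥ s t j)) ⟩
      λS S (h₁ +ᵥ h₂)                  ≡⟨ λS-+ᵥ h₁ h₂ ⟩
      λS S h₁ + λS S h₂                ≡⟨ cong₂ _+_ (λS-σRes-≡0 p S S-uniform s) (λS-σRes-≡0 p S T-uniform t) ⟩
      0ℚ + 0ℚ                          ≡⟨ +-identityʳ 0ℚ ⟩
      0ℚ                               ∎)
    where open ≡-Reasoning

mainTheorem6 : ∀ {n} (p : Preposet n) (S T : Subset n)
    → Nonempty S → Nonempty T
    → (∀ i → i ∈ S → i ∈ T → ⊥)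
    → (∀ i → i ∈ S ⊎ i ∈ T)
    → UpClosed p S → DownClosed p T
    → (∀ h₁ h₂ → σRes p S h₁ → σRes p T h₂ → σ p (mST S h₁ h₂))
      × (∀ h₁ h₂ h₁' h₂' → σRes p S h₁ → σRes p T h₂ → σRes p S h₁' → σRes p T h₂'
           → mST S h₁ h₂ ≗ᵥ mST S h₁' h₂' → (h₁ ≗ᵥ h₁') × (h₂ ≗ᵥ h₂'))
      × (∀ h → (Face p S h → ∃[ h₁ ] ∃[ h₂ ] (σRes p S h₁ × σRes p T h₂ × (mST S h₁ h₂ ≗ᵥ h)))
             × (∃[ h₁ ] ∃[ h₂ ] (σRes p S h₁ × σRes p T h₂ × (mST S h₁ h₂ ≗ᵥ h)) → Face p S h))
mainTheorem6 p S T _ _ disjoint cover S-up _ =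
  mST-σ , (λ _ _ _ _ → mST-injective) , λ _ → Face⇒Image , Image⇒Face
  where open Decomposition p S T disjoint cover S-up
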